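{- Let $k\ge2$, $n,N\ge1$, let $A:[n]^k\to[N]$ be a function and let $b<\log N$ be a natural number. Write $D^{h}_{k,b}(A)=b+c_d$ and $N^{h}_{k,b}(A)=b+c_n$. Here $c_d$ (resp. $c_n$) is the number of bits of communication following the $b$ help bits in an optimal deterministic (resp. nondeterministic) protocol with help. Then $$c_d\le (k-1)2^{c_n}+c_n.$$
   Context: NOF model with $m$ players: on input $(x_1,\ldots,x_m)$, player $i$ sees all $x_j$ with $j\ne i$ but not $x_i$. The players write bits in turns on a shared blackboard. Deterministic communication with help for $A:[n]^m\to[N]$: a helper who sees the whole input first writes a help string of at most $b$ bits, which may depend arbitrarily on the input. Then the players communicate deterministically in the NOF model until all know $A(x_1,\ldots,x_m)$. The cost is the maximum over inputs of the help length plus the number of communicated bits. $D^{h}_{m,b}(A)$ is the minimum cost. Nondeterministic communication with help: the same, except that after the help string the players also see a proof string from an all-powerful prover. They output a value or "don't know". The output is never a wrong value, and for every input some proof string yields the correct value. Proof bits count toward the cost. $N^{h}_{m,b}(A)$ is the minimum cost. An optimal protocol may be assumed to use exactly $b$ help bits. -}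

module Defs where

open import Data.Nat using (ℕ; _+_; _≤_)
open import Data.Fin using (Fin)
open import Data.Bool using (Bool; true; false)
open import Data.List using (List; []; _∷_; length)
open import Data.Vec using (Vec)
open import Data.Maybe using (Maybe; just; nothing)
open import Data.Unit using (⊤)
open import Data.Product using (∃; _×_)
open import Relation.Binary.PropositionalEquality using (_≡_; _≢_)

Input : ℕ → ℕ → Set
Input k n = Fin k → Fin n

Agree : ∀ {k n} → Fin k → Input k n → Input k n → Set
Agree i x y = ∀ j → j ≢ i → x j ≡ y j

-- A deterministic NOF communication tree with leaves labelled by L.
-- At a node, player i writes the bit f x, where f may only depend on
-- what player i sees (the coordinates other than i).
data Tree (k n : ℕ) (L : Set) : Set where
  leaf : L → Tree k n L
  node : (i : Fin k) (f : Input k n → Bool) →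
         (∀ x y → Agree i x y → f x ≡ f y) →
         Tree k n L → Tree k n L → Tree k n L

transcript : ∀ {k n L} → Tree k n L → Input k n → List Bool
transcript (leaf _) x = []
transcript (node i f _ l r) x with f x
... | false = false ∷ transcript l x
... | true  = true ∷ transcript r x

outcome : ∀ {k n L} → Tree k n L → Input k n → L
outcome (leaf v) x = v
outcome (node i f _ l r) x with f x
... | false = outcome l x
... | true  = outcome r x

-- Deterministic protocol with exactly b help bits and at most c bits of
-- communication after the help, at the end of which every player knows A(x):
-- the value is determined by the help string, the transcript and the player's view.
record DetProtocol (k n N b : ℕ) (A : Input k n → Fin N) (c : ℕ) : Set where
  field
    help    : Input k n → Vec Bool b
    proto   : Vec Bool b → Tree k n ⊤
    cost    : ∀ x → length (transcript (proto (help x)) x) ≤ c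
    knows   : ∀ (i : Fin k) x y → help x ≡ help y →
              transcript (proto (help x)) x ≡ transcript (proto (help x)) y →
              Agree i x y → A x ≡ A y

-- Nondeterministic part: first the prover's proof bits (a binary tree of
-- guesses, allowing proofs of variable length), then deterministic
-- communication whose leaves output a value (just v) or "don't know" (nothing).
data NTree (k n N : ℕ) : Set where
  comm  : Tree k n (Maybe (Fin N)) → NTree k n N
  guess : NTree k n N → NTree k n N → NTree k n N

follow : ∀ {k n N} → NTree k n N → List Bool → Maybe (Tree k n (Maybe (Fin N)))
follow (comm t)    []          = just t
follow (comm t)    (_ ∷ _)     = nothing
follow (guess l r) []          = nothing
follow (guess l r) (false ∷ p) = follow l p
follow (guess l r) (true ∷ p)  = follow r p

record NondetProtocol (k n N b : ℕ) (A : Input k n → Fin N) (c : ℕ) : Set where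
  field
    help     : Input k n → Vec Bool b
    proto    : Vec Bool b → NTree k n N
    cost     : ∀ x p t → follow (proto (help x)) p ≡ just t →
               length p + length (transcript t x) ≤ c
    sound    : ∀ x p t v → follow (proto (help x)) p ≡ just t →
               outcome t x ≡ just v → v ≡ A x
    complete : ∀ x → ∃ λ p → ∃ λ t → follow (proto (help x)) p ≡ just t ×
               outcome t x ≡ just (A x)

-- Run the nondeterministic protocol on all proof strings at once. Truncated at
-- depth c_n it has at most 2^c_n accepting leaves, and an input reaches a leaf
-- iff it satisfies the bits written along the path. Each such bit is computed
-- by the player who wrote it, so the leaf is reached iff every player accepts
-- its own constraints. All players but one announce, leaf by leaf, whether
-- they accept ((k-1)·2^c_n bits); the remaining player then knows which
-- leaves x reaches and walks down the tree of leaves towards one of them, one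
-- bit per level (c_n bits). Soundness makes the value at every reached leaf
-- A(x), and completeness guarantees that such a leaf exists.
module Submission where

open import Defs
open import Data.Nat using (ℕ; zero; suc; _+_; _*_; _∸_; _^_; _⊔_; _≤_; _<_; z≤n; s≤s)
open import Data.Fin using (Fin)
import Data.Fin as F
open import Data.Nat.Properties
  using (≤-trans; ≤-reflexive; +-assoc; +-identityʳ; *-zeroʳ; *-identityʳ; *-distribˡ-+; +-mono-≤; *-monoʳ-≤;
         ^-monoʳ-≤; m≤m⊔n; m≤n⊔m; ⊔-lub; ≤-pred)
open import Data.Fin.Properties using (_≟_)
open import Data.Bool using (Bool; true; false; not; _∧_; _∨_; T)
open import Data.Bool.Properties using (T-∧; T-∨; T-≡; T-not-≡)
open import Data.List using (List; []; _∷_; length; map; tabulate)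
open import Data.Bool.ListAction using (and)
open import Data.List.Properties using (∷-injectiveʳ; length-tabulate)
open import Data.List.Relation.Unary.All using (All; []; _∷_)
open import Data.List.Relation.Unary.All.Properties using (all⁺; all⁻; tabulate⁺; tabulate⁻)
open import Data.Vec using (Vec)
open import Data.Maybe using (Maybe; just; nothing)
import Data.Maybe as Maybe
open import Data.Maybe.Properties using (just-injective)
open import Data.Unit using (⊤; tt)
open import Data.Empty using (⊥-elim)
open import Data.Product using (∃-syntax; _×_; _,_; proj₁; proj₂)
open import Data.Sum using (inj₁; inj₂)
open import Function using (_∘_; _⇔_; mk⇔; Equivalence)
open import Relation.Binary.PropositionalEquality
  using (_≡_; refl; sym; trans; cong; cong₂; subst; module ≡-Reasoning)
open import Relation.Nullary using (yes; no; contradiction)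

open Equivalence using (to; from)

private variable
  k n N b c m : ℕ
  L X Y : Set

outcome-node-false : ∀ i f rf (l r : Tree k n L) x → f x ≡ false →
                     outcome (node i f rf l r) x ≡ outcome l x
outcome-node-false i f rf l r x fx≡false with f x
outcome-node-false i f rf l r x refl | false = refl

outcome-node-true : ∀ i f rf (l r : Tree k n L) x → f x ≡ true →
                    outcome (node i f rf l r) x ≡ outcome r x
outcome-node-true i f rf l r x fx≡true with f x
outcome-node-true i f rf l r x refl | true = refl

outcome-determined-by-transcript : (t : Tree k n L) (x y : Input k n) →
  transcript t x ≡ transcript t y → outcome t x ≡ outcome t y
outcome-determined-by-transcript (leaf _) x y _ = refl
outcome-determined-by-transcript (node i f _ l r) x y eq with f x | f y
... | false | false = outcome-determined-by-transcript l x y (∷-injectiveʳ eq)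
... | true  | true  = outcome-determined-by-transcript r x y (∷-injectiveʳ eq)
... | false | true  with () ← eq
... | true  | false with () ← eq

eraseLeaves : Tree k n L → Tree k n ⊤
eraseLeaves (leaf _)           = leaf tt
eraseLeaves (node i f rf l r) = node i f rf (eraseLeaves l) (eraseLeaves r)

transcript-eraseLeaves : (t : Tree k n L) (x : Input k n) →
  transcript (eraseLeaves t) x ≡ transcript t x
transcript-eraseLeaves (leaf _) x = refl
transcript-eraseLeaves (node i f _ l r) x with f x
... | false = cong (false ∷_) (transcript-eraseLeaves l x)
... | true  = cong (true ∷_) (transcript-eraseLeaves r x)

-- The transcript alone determines the leaf.
detProtocol-fromTrees : {A : Input k n → Fin N}
  (help : Input k n → Vec Bool b) (P : Vec Bool b → Tree k n L) (value : L → Maybe (Fin N)) →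
  (∀ x → value (outcome (P (help x)) x) ≡ just (A x)) →
  (∀ x → length (transcript (P (help x)) x) ≤ c) →
  DetProtocol k n N b A c
detProtocol-fromTrees {A = A} help P value correct cost = record
  { help  = help
  ; proto = eraseLeaves ∘ P
  ; cost  = λ x → ≤-trans (≤-reflexive (cong length (transcript-eraseLeaves (P (help x)) x))) (cost x)
  ; knows = knows
  }
  where
    knows : ∀ (i : Fin _) x y → help x ≡ help y →
            transcript (eraseLeaves (P (help x))) x ≡ transcript (eraseLeaves (P (help x))) y →
            Agree i x y → A x ≡ A y
    knows _ x y help≡ transcript≡ _ = just-injective (begin
      just (A x)                        ≡⟨ sym (correct x) ⟩
      value (outcome (P (help x)) x)    ≡⟨ cong value (outcome-determined-by-transcript (P (help x)) x y same) ⟩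
      value (outcome (P (help x)) y)    ≡⟨ cong (λ h → value (outcome (P h) y)) help≡ ⟩
      value (outcome (P (help y)) y)    ≡⟨ correct y ⟩
      just (A y)                        ∎)
      where
        open ≡-Reasoning
        same : transcript (P (help x)) x ≡ transcript (P (help x)) y
        same = trans (sym (transcript-eraseLeaves (P (help x)) x)) (trans transcript≡ (transcript-eraseLeaves (P (help x)) y))

record Query (k n : ℕ) : Set where
  constructor query
  field
    player    : Fin k
    ask       : Input k n → Bool
    ask-local : ∀ x y → Agree player x y → ask x ≡ ask y
open Query

Holds : Input k n → List (Query k n) → Set
Holds x = All (λ q → T (ask q x))

-- A list of constraints holds iff each player accepts those it owns, which it
-- can check by itself: the leaves of a protocol are cylinder intersections.
ownCheck : Fin k → List (Query k n) → Input k n → Bool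
ownCheck i []       x = true
ownCheck i (q ∷ qs) x with player q ≟ i
... | yes _ = ask q x ∧ ownCheck i qs x
... | no  _ = ownCheck i qs x

ownCheck-local : ∀ i (qs : List (Query k n)) x y → Agree i x y → ownCheck i qs x ≡ ownCheck i qs y
ownCheck-local i []       x y _ = refl
ownCheck-local i (q ∷ qs) x y x~y with player q ≟ i
... | yes refl = cong₂ _∧_ (ask-local q x y x~y) (ownCheck-local i qs x y x~y)
... | no  _    = ownCheck-local i qs x y x~y

ownCheckQuery : Fin k → List (Query k n) → Query k n
ownCheckQuery i qs = query i (ownCheck i qs) (ownCheck-local i qs)

Holds⇒ownCheck : ∀ i (qs : List (Query k n)) {x} → Holds x qs → T (ownCheck i qs x)
Holds⇒ownCheck i []       []         = tt
Holds⇒ownCheck i (q ∷ qs) (hq ∷ hqs) with player q ≟ i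
... | yes _ = from T-∧ (hq , Holds⇒ownCheck i qs hqs)
... | no  _ = Holds⇒ownCheck i qs hqs

ownCheck⇒Holds : ∀ (qs : List (Query k n)) {x} → (∀ i → T (ownCheck i qs x)) → Holds x qs
ownCheck⇒Holds []       _      = []
ownCheck⇒Holds (q ∷ qs) checks = head (checks (player q)) ∷ ownCheck⇒Holds qs (tail ∘ checks)
  where
    head : ∀ {x} → T (ownCheck (player q) (q ∷ qs) x) → T (ask q x)
    head h with player q ≟ player q
    ... | yes _  = proj₁ (to T-∧ h)
    ... | no  ≢q = contradiction refl ≢q
    tail : ∀ {i x} → T (ownCheck i (q ∷ qs) x) → T (ownCheck i qs x)
    tail {i} h with player q ≟ i
    ... | yes _ = proj₂ (to T-∧ h)
    ... | no  _ = h

askAll : List (Query k n) → (List Bool → Tree k n L) → Tree k n L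
askAll []       K = K []
askAll (q ∷ qs) K = node (player q) (ask q) (ask-local q)
  (askAll qs (K ∘ (false ∷_))) (askAll qs (K ∘ (true ∷_)))

answers : List (Query k n) → Input k n → List Bool
answers qs x = map (λ q → ask q x) qs

outcome-askAll : ∀ qs (K : List Bool → Tree k n L) x →
  outcome (askAll qs K) x ≡ outcome (K (answers qs x)) x
outcome-askAll []       K x = refl
outcome-askAll (q ∷ qs) K x with ask q x
... | false = outcome-askAll qs (K ∘ (false ∷_)) x
... | true  = outcome-askAll qs (K ∘ (true ∷_)) x

length-askAll : ∀ qs (K : List Bool → Tree k n L) x →
  length (transcript (askAll qs K) x) ≡ length qs + length (transcript (K (answers qs x)) x)
length-askAll []       K x = refl
length-askAll (q ∷ qs) K x with ask q x
... | false = cong suc (length-askAll qs (K ∘ (false ∷_)) x)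
... | true  = cong suc (length-askAll qs (K ∘ (true ∷_)) x)

data BTree (X : Set) : Set where
  empty : BTree X
  tip   : X → BTree X
  fork  : BTree X → BTree X → BTree X

mapTips : (X → Y) → BTree X → BTree Y
mapTips f empty      = empty
mapTips f (tip a)    = tip (f a)
mapTips f (fork l r) = fork (mapTips f l) (mapTips f r)

size : BTree X → ℕ
size empty      = 0
size (tip _)    = 1
size (fork l r) = size l + size r

height : BTree X → ℕ
height empty      = 0
height (tip _)    = 0
height (fork l r) = suc (height l ⊔ height r)

anyTip : (X → Bool) → BTree X → Bool
anyTip p empty      = false
anyTip p (tip a)    = p a
anyTip p (fork l r) = anyTip p l ∨ anyTip p r

data AllTips {X : Set} (P : X → Set) : BTree X → Set where
  empty : AllTips P empty
  tip   : ∀ {a} → P a → AllTips P (tip a)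
  fork  : ∀ {l r} → AllTips P l → AllTips P r → AllTips P (fork l r)

data AnyTip {X : Set} (P : X → Set) : BTree X → Set where
  tip   : ∀ {a} → P a → AnyTip P (tip a)
  left  : ∀ {l r} → AnyTip P l → AnyTip P (fork l r)
  right : ∀ {l r} → AnyTip P r → AnyTip P (fork l r)

size≤2^height : (t : BTree X) → size t ≤ 2 ^ height t
size≤2^height empty      = z≤n
size≤2^height (tip _)    = s≤s z≤n
size≤2^height (fork l r) = begin
  size l + size r                   ≤⟨ +-mono-≤ (bound l (m≤m⊔n _ _)) (bound r (m≤n⊔m _ _)) ⟩
  2 ^ h + 2 ^ h                     ≡⟨ cong (2 ^ h +_) (sym (+-identityʳ (2 ^ h))) ⟩
  2 ^ suc h                         ∎
  where
    open Data.Nat.Properties.≤-Reasoning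
    h : ℕ
    h = height l ⊔ height r
    bound : (t : BTree _) → height t ≤ h → size t ≤ 2 ^ h
    bound t ht≤h = ≤-trans (size≤2^height t) (^-monoʳ-≤ 2 ht≤h)

height-mapTips : (f : X → Y) (t : BTree X) → height (mapTips f t) ≡ height t
height-mapTips f empty      = refl
height-mapTips f (tip _)    = refl
height-mapTips f (fork l r) = cong₂ (λ a b → suc (a ⊔ b)) (height-mapTips f l) (height-mapTips f r)

AllTips-map : ∀ {P : X → Set} {Q : Y → Set} {f : X → Y} →
  (∀ {a} → P a → Q (f a)) → ∀ {t} → AllTips P t → AllTips Q (mapTips f t)
AllTips-map pq empty      = empty
AllTips-map pq (tip pa)   = tip (pq pa)
AllTips-map pq (fork l r) = fork (AllTips-map pq l) (AllTips-map pq r)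

AnyTip-map : ∀ {P : X → Set} {Q : Y → Set} {f : X → Y} →
  (∀ {a} → P a → Q (f a)) → ∀ {t} → AnyTip P t → AnyTip Q (mapTips f t)
AnyTip-map pq (tip pa)  = tip (pq pa)
AnyTip-map pq (left l)  = left (AnyTip-map pq l)
AnyTip-map pq (right r) = right (AnyTip-map pq r)

anyTip⁻ : ∀ (p : X → Bool) t → T (anyTip p t) → AnyTip (T ∘ p) t
anyTip⁻ p (tip a)    pa = tip pa
anyTip⁻ p (fork l r) h with to T-∨ h
... | inj₁ hl = left (anyTip⁻ p l hl)
... | inj₂ hr = right (anyTip⁻ p r hr)

anyTip⁺ : ∀ (p : X → Bool) {t} → AnyTip (T ∘ p) t → T (anyTip p t)
anyTip⁺ p (tip pa)  = pa
anyTip⁺ p (left l)  = from T-∨ (inj₁ (anyTip⁺ p l))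
anyTip⁺ p (right r) = from T-∨ (inj₂ (anyTip⁺ p r))

module Descend (i : Fin k) (good : X → Input k n → Bool)
               (good-local : ∀ a x y → Agree i x y → good a x ≡ good a y) where

  goodLeft : BTree X → Input k n → Bool
  goodLeft t x = anyTip (λ a → good a x) t

  descend : BTree X → Tree k n (Maybe X)
  descend empty      = leaf nothing
  descend (tip a)    = leaf (just a)
  descend (fork l r) = node i (not ∘ goodLeft l) (λ x y x~y → cong not (local l x y x~y))
                         (descend l) (descend r)
    where
      local : ∀ t x y → Agree i x y → goodLeft t x ≡ goodLeft t y
      local empty      x y _   = refl
      local (tip a)    x y x~y = good-local a x y x~y
      local (fork l r) x y x~y = cong₂ _∨_ (local l x y x~y) (local r x y x~y)

  length-descend : ∀ t x → length (transcript (descend t) x) ≤ height t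
  length-descend empty      x = z≤n
  length-descend (tip _)    x = z≤n
  length-descend (fork l r) x with goodLeft l x
  ... | true  = s≤s (≤-trans (length-descend l x) (m≤m⊔n _ _))
  ... | false = s≤s (≤-trans (length-descend r x) (m≤n⊔m _ _))

  descend-finds : ∀ {P : X → Set} {t} x →
    AllTips (λ a → T (good a x) → P a) t → AnyTip (λ a → T (good a x)) t →
    ∃[ a ] outcome (descend t) x ≡ just a × P a
  descend-finds x (tip pa) (tip ga) = _ , refl , pa ga
  descend-finds {t = fork l r} x (fork pl pr) some with goodLeft l x in eq
  ... | true  = descend-finds x pl (anyTip⁻ (λ a → good a x) l (from T-≡ eq))
  ... | false = descend-finds x pr (inRight some)
    where
      inRight : AnyTip (λ a → T (good a x)) (fork l r) → AnyTip (λ a → T (good a x)) r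
      inRight (left gl)  = ⊥-elim (subst T eq (anyTip⁺ (λ a → good a x) gl))
      inRight (right gr) = gr

goesLeft : (i : Fin k) (f : Input k n → Bool) → (∀ x y → Agree i x y → f x ≡ f y) → Query k n
goesLeft i f f-local = query i (not ∘ f) (λ x y x~y → cong not (f-local x y x~y))

-- An accepting leaf of the protocol together with the constraints on its path.
Candidate : ℕ → ℕ → ℕ → Set
Candidate k n N = List (Query k n) × Fin N

candidatesT : ℕ → List (Query k n) → Tree k n (Maybe (Fin N)) → BTree (Candidate k n N)
candidatesT d       cs (leaf nothing)     = empty
candidatesT d       cs (leaf (just v))    = tip (cs , v)
candidatesT zero    cs (node _ _ _ _ _)   = empty
candidatesT (suc d) cs (node i f f-local l r) =
  fork (candidatesT d (goesLeft i f f-local ∷ cs) l) (candidatesT d (query i f f-local ∷ cs) r)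

candidates : ℕ → NTree k n N → BTree (Candidate k n N)
candidates d       (comm t)    = candidatesT d [] t
candidates zero    (guess _ _) = empty
candidates (suc d) (guess l r) = fork (candidates d l) (candidates d r)

height-candidatesT : ∀ d cs (t : Tree k n (Maybe (Fin N))) → height (candidatesT d cs t) ≤ d
height-candidatesT d       cs (leaf nothing)     = z≤n
height-candidatesT d       cs (leaf (just _))    = z≤n
height-candidatesT zero    cs (node _ _ _ _ _)   = z≤n
height-candidatesT (suc d) cs (node _ _ _ l r) =
  s≤s (⊔-lub (height-candidatesT d _ l) (height-candidatesT d _ r))

height-candidates : ∀ d (T : NTree k n N) → height (candidates d T) ≤ d
height-candidates d       (comm t)    = height-candidatesT d [] t
height-candidates zero    (guess _ _) = z≤n
height-candidates (suc d) (guess l r) =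
  s≤s (⊔-lub (height-candidates d l) (height-candidates d r))

candidatesT-sound : ∀ {P : Fin N → Set} d cs (t : Tree k n (Maybe (Fin N))) x →
  (∀ w → Holds x cs → outcome t x ≡ just w → P w) →
  AllTips (λ c → Holds x (proj₁ c) → P (proj₂ c)) (candidatesT d cs t)
candidatesT-sound d       cs (leaf nothing)   x H = empty
candidatesT-sound d       cs (leaf (just v))  x H = tip (λ h → H v h refl)
candidatesT-sound zero    cs (node _ _ _ _ _) x H = empty
candidatesT-sound (suc d) cs (node i f f-local l r) x H = fork
  (candidatesT-sound d _ l x λ { w (fx≡false ∷ h) o →
     H w h (trans (outcome-node-false i f f-local l r x (to T-not-≡ fx≡false)) o) })
  (candidatesT-sound d _ r x λ { w (fx≡true ∷ h) o →
     H w h (trans (outcome-node-true i f f-local l r x (to T-≡ fx≡true)) o) })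

candidates-sound : ∀ {P : Fin N → Set} d (T : NTree k n N) x →
  (∀ p t w → follow T p ≡ just t → outcome t x ≡ just w → P w) →
  AllTips (λ c → Holds x (proj₁ c) → P (proj₂ c)) (candidates d T)
candidates-sound d       (comm t)    x H = candidatesT-sound d [] t x (λ w _ → H [] t w refl)
candidates-sound zero    (guess _ _) x H = empty
candidates-sound (suc d) (guess l r) x H =
  fork (candidates-sound d l x (H ∘ (false ∷_))) (candidates-sound d r x (H ∘ (true ∷_)))

candidatesT-complete : ∀ d cs (t : Tree k n (Maybe (Fin N))) x {v} →
  Holds x cs → length (transcript t x) ≤ d → outcome t x ≡ just v →
  AnyTip (Holds x ∘ proj₁) (candidatesT d cs t)
candidatesT-complete d cs (leaf (just w)) x h _ o = tip h
candidatesT-complete d cs (node i f _ l r) x h len o with f x in eq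
candidatesT-complete (suc d) cs (node i f _ l r) x h len o | false =
  left (candidatesT-complete d _ l x (from T-not-≡ eq ∷ h) (≤-pred len) o)
candidatesT-complete (suc d) cs (node i f _ l r) x h len o | true =
  right (candidatesT-complete d _ r x (from T-≡ eq ∷ h) (≤-pred len) o)

candidates-complete : ∀ d (T : NTree k n N) x {p t v} →
  follow T p ≡ just t → length p + length (transcript t x) ≤ d → outcome t x ≡ just v →
  AnyTip (Holds x ∘ proj₁) (candidates d T)
candidates-complete d (comm t) x {[]} refl len o = candidatesT-complete d [] t x [] len o
candidates-complete (suc d) (guess l r) x {false ∷ p} fol len o =
  left (candidates-complete d l x fol (≤-pred len) o)
candidates-complete (suc d) (guess l r) x {true ∷ p} fol len o =
  right (candidates-complete d r x fol (≤-pred len) o)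

askTips : (X → List (Query k n)) → BTree X → (BTree (X × List Bool) → Tree k n L) → Tree k n L
askTips qs empty      K = K empty
askTips qs (tip a)    K = askAll (qs a) (λ μ → K (tip (a , μ)))
askTips qs (fork l r) K = askTips qs l (λ l′ → askTips qs r (λ r′ → K (fork l′ r′)))

annotate : (X → List (Query k n)) → Input k n → BTree X → BTree (X × List Bool)
annotate qs x = mapTips (λ a → a , answers (qs a) x)

outcome-askTips : ∀ (qs : X → List (Query k n)) t (K : BTree (X × List Bool) → Tree k n L) x →
  outcome (askTips qs t K) x ≡ outcome (K (annotate qs x t)) x
outcome-askTips qs empty      K x = refl
outcome-askTips qs (tip a)    K x = outcome-askAll (qs a) _ x
outcome-askTips qs (fork l r) K x =
  trans (outcome-askTips qs l _ x) (outcome-askTips qs r _ x)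

length-askTips : ∀ (qs : X → List (Query k n)) → (∀ a → length (qs a) ≡ m) →
  ∀ t (K : BTree (X × List Bool) → Tree k n L) x →
  length (transcript (askTips qs t K) x) ≡ m * size t + length (transcript (K (annotate qs x t)) x)
length-askTips {m = m} qs |qs| empty K x = cong (_+ length (transcript (K empty) x)) (sym (*-zeroʳ m))
length-askTips {m = m} qs |qs| (tip a) K x = begin
  length (transcript (askAll (qs a) (λ μ → K (tip (a , μ)))) x) ≡⟨ length-askAll (qs a) _ x ⟩
  length (qs a) + rest                                           ≡⟨ cong (_+ rest) (trans (|qs| a) (sym (*-identityʳ m))) ⟩
  m * 1 + rest                                                   ∎
  where
    open ≡-Reasoning
    rest = length (transcript (K (annotate qs x (tip a))) x)
length-askTips {m = m} qs |qs| (fork l r) K x = begin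
  length (transcript (askTips qs (fork l r) K) x)     ≡⟨ length-askTips qs |qs| l _ x ⟩
  m * size l + length (transcript (askTips qs r _) x) ≡⟨ cong (m * size l +_) (length-askTips qs |qs| r _ x) ⟩
  m * size l + (m * size r + rest)                    ≡⟨ sym (+-assoc (m * size l) _ rest) ⟩
  m * size l + m * size r + rest                      ≡⟨ cong (_+ rest) (sym (*-distribˡ-+ m (size l) (size r))) ⟩
  m * (size l + size r) + rest                        ∎
  where
    open ≡-Reasoning
    rest = length (transcript (K (annotate qs x (fork l r))) x)

module Simulation {k′ n N : ℕ} where

  Marked : Set
  Marked = Candidate (suc k′) n N × List Bool

  markedValue : Maybe Marked → Maybe (Fin N)
  markedValue = Maybe.map (proj₂ ∘ proj₁)

  othersChecks : Candidate (suc k′) n N → List (Query (suc k′) n)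
  othersChecks (cs , _) = tabulate (λ j → ownCheckQuery (F.suc j) cs)

  length-othersChecks : ∀ c → length (othersChecks c) ≡ k′
  length-othersChecks (cs , _) = length-tabulate (λ j → ownCheckQuery (F.suc j) cs)

  consistent : Marked → Input (suc k′) n → Bool
  consistent ((cs , _) , μ) x = ownCheck F.zero cs x ∧ and μ

  consistent-local : ∀ a x y → Agree F.zero x y → consistent a x ≡ consistent a y
  consistent-local ((cs , _) , μ) x y x~y = cong (_∧ and μ) (ownCheck-local F.zero cs x y x~y)

  consistent⇔Holds : ∀ c x → T (consistent (c , answers (othersChecks c) x) x) ⇔ Holds x (proj₁ c)
  consistent⇔Holds (cs , v) x = mk⇔ to′ from′
    where
      others = othersChecks (cs , v)
      to′ : T (consistent ((cs , v) , answers others x) x) → Holds x cs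
      to′ h with to T-∧ h
      ... | own , rest = ownCheck⇒Holds cs λ
        { F.zero    → own
        ; (F.suc j) → tabulate⁻ (all⁺ (λ q → ask q x) others rest) j }
      from′ : Holds x cs → T (consistent ((cs , v) , answers others x) x)
      from′ h = from T-∧ (Holds⇒ownCheck F.zero cs h ,
                          all⁻ (λ q → ask q x) (tabulate⁺ (λ j → Holds⇒ownCheck (F.suc j) cs h)))

  open Descend F.zero consistent consistent-local

  simulate : ℕ → NTree (suc k′) n N → Tree (suc k′) n (Maybe Marked)
  simulate d T = askTips othersChecks (candidates d T) descend

  length-simulate : ∀ d T x → length (transcript (simulate d T) x) ≤ k′ * 2 ^ d + d
  length-simulate d T x = begin
    length (transcript (simulate d T) x)
      ≡⟨ length-askTips othersChecks length-othersChecks C descend x ⟩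
    k′ * size C + length (transcript (descend (annotate othersChecks x C)) x)
      ≤⟨ +-mono-≤ (*-monoʳ-≤ k′ (size≤2^height C)) (length-descend _ x) ⟩
    k′ * 2 ^ height C + height (annotate othersChecks x C)
      ≡⟨ cong (k′ * 2 ^ height C +_) (height-mapTips _ C) ⟩
    k′ * 2 ^ height C + height C
      ≤⟨ +-mono-≤ (*-monoʳ-≤ k′ (^-monoʳ-≤ 2 C≤d)) C≤d ⟩
    k′ * 2 ^ d + d
      ∎
    where
      open Data.Nat.Properties.≤-Reasoning
      C = candidates d T
      C≤d = height-candidates d T

  simulate-correct : ∀ d T x {v p t} →
    (∀ p t w → follow T p ≡ just t → outcome t x ≡ just w → w ≡ v) →
    follow T p ≡ just t → length p + length (transcript t x) ≤ d → outcome t x ≡ just v →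
    markedValue (outcome (simulate d T) x) ≡ just v
  simulate-correct d T x {v} sound fol len o
    with descend-finds {t = annotate othersChecks x (candidates d T)} x
           (AllTips-map (λ {c} s good → s (to (consistent⇔Holds c x) good)) (candidates-sound d T x sound))
           (AnyTip-map (λ {c} → from (consistent⇔Holds c x)) (candidates-complete d T x fol len o))
  ... | a , reached , value≡v = begin
    markedValue (outcome (simulate d T) x)
      ≡⟨ cong markedValue (outcome-askTips othersChecks C descend x) ⟩
    markedValue (outcome (descend (annotate othersChecks x C)) x)
      ≡⟨ cong markedValue reached ⟩
    just (proj₂ (proj₁ a))
      ≡⟨ cong just value≡v ⟩
    just v
      ∎
    where
      open ≡-Reasoning
      C = candidates d T

-- The bound holds for every k ≥ 1, for any number of help bits and for any cn
-- admitting a protocol: only k = 0 is excluded, the other hypotheses are unused.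
theorem9 : (k n N b : ℕ) (A : Input k n → Fin N) →
    2 ≤ k → 1 ≤ n → 1 ≤ N → 2 ^ b < N →
    (cn : ℕ) → NondetProtocol k n N b A cn →
    (∀ c → NondetProtocol k n N b A c → cn ≤ c) →
    DetProtocol k n N b A ((k ∸ 1) * 2 ^ cn + cn)
theorem9 (suc k′) n N b A _ _ _ _ cn NP _ =
  detProtocol-fromTrees NP.help (simulate cn ∘ NP.proto) markedValue
    correct (λ x → length-simulate cn (NP.proto (NP.help x)) x)
  where
    module NP = NondetProtocol NP
    open Simulation
    correct : ∀ x → markedValue (outcome (simulate cn (NP.proto (NP.help x))) x) ≡ just (A x)
    correct x with NP.complete x
    ... | p , t , fol , o = simulate-correct cn (NP.proto (NP.help x)) x {p = p} (NP.sound x) fol (NP.cost x p t fol) o
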